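{- For any heap transformer $\tau$ (any of $\mathit{new}(\cdot,x)$, $\mathit{assign}(\cdot,x,y)$, $\mathit{lookup}(\cdot,x,y)$, $\mathit{update}(\cdot,x,y)$, for any pointer variables $x,y\in P$) and any weighted singly linked heaps $H_1,H_2$ over $P$: if $H_1\sim H_2$ then $\tau(H_1)\sim\tau(H_2)$.
   Context: Fix a finite set $P$ of pointer variables containing a distinguished variable $\mathbf{null}$. A weighted heap over $P$ is $H=\langle L,G,w\rangle$ with $G$ a finite directed graph (vertices $V(G)$, edges $E(G)$), $w:E(G)\to\mathbb{N}_{>0}$, and $L:P\to V(G)$. $H$ is singly linked iff every vertex $v$ either has outdegree $1$ and $v\neq L(\mathbf{null})$, or has outdegree $0$ and $v=L(\mathbf{null})$; for $v\ne L(\mathbf{null})$, $\mathrm{succ}(v)$ is its unique successor. Subdividing an edge $(u,v)$: introduce a fresh vertex $q$ and replace $(u,v)$ by $(u,q),(q,v)$ with positive weights summing to $w(u,v)$. A subdivision of $H$ is any heap obtained from $H$ by finitely many (possibly zero) such steps. Transformers: $\mathit{new}(H,x)$ adds a fresh vertex $q$, an edge $(q,L(\mathbf{null}))$ of weight $1$, and sets $L[x\mapsto q]$. $\mathit{assign}(H,x,y)$ sets $L[x\mapsto L(y)]$. $\mathit{lookup}(H,x,y)$: let $v=L(y)$; if the edge leaving $v$ has weight $1$, set $L[x\mapsto\mathrm{succ}(v)]$; otherwise first subdivide that edge into a first edge of weight $1$ to a fresh vertex $q$ followed by the remainder, and set $L[x\mapsto q]$. $\mathit{update}(H,x,y)$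 replaces the edge leaving $L(x)$ by the edge $(L(x),L(y))$ of weight $1$. (Lookup and update are applied only where the required successor exists.) Reachable sub-heap $H|_P$: $H$ restricted to vertices reachable from some $L(p)$, $p\in P$. Heaps $H,H'$ are isomorphic iff there is a weight-preserving graph isomorphism $f$ between $H|_P$ and $H'|_P$ with $f(L(p))=L'(p)$ for all $p\in P$. Heaps $H,H'$ are homeomorphic, $H\sim H'$, iff some subdivision of $H$ is isomorphic to some subdivision of $H'$. -}

module Defs where

open import Data.Nat as ℕ using (ℕ; _<_; _∸_; _+_)
open import Data.Fin using (Fin; zero; suc; _≟_)
open import Data.Bool using (Bool; true; false; if_then_else_; _∧_)
open import Data.Maybe as Maybe using (Maybe; just; nothing; is-just)
open import Data.List using (List; []; _∷_; length; filterᵇ; mapMaybe; allFin)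
open import Data.Product using (Σ; _×_; _,_)
open import Data.Sum using (_⊎_)
open import Data.Unit using (⊤)
open import Relation.Binary.PropositionalEquality using (_≡_; _≢_)
open import Relation.Nullary using (yes; no; does)

-- Pointer variables: P = Fin k, with a distinguished variable `null : Fin k`
-- passed explicitly wherever needed.
--
-- A heap over P: vertices Fin V; a (simple) directed graph with weights
-- given by  w u v = just n  iff (u,v) is an edge of weight n  (nothing = no edge);
-- and the labelling L : P → V(G).

record Heap (k : ℕ) : Set where
  constructor heap
  field
    V : ℕ
    w : Fin V → Fin V → Maybe ℕ
    L : Fin k → Fin V

open Heap public

PositiveWeights : ∀ {k} → Heap k → Set
PositiveWeights H = ∀ u v n → w H u v ≡ just n → 0 < n

_[_↦_] : ∀ {k V} → (Fin k → Fin V) → Fin k → Fin V → Fin k → Fin V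
(L [ x ↦ v ]) p with p ≟ x
... | yes _ = v
... | no _ = L p

outdeg : ∀ {k} (H : Heap k) → Fin (V H) → ℕ
outdeg H v = length (filterᵇ (λ u → is-just (w H v u)) (allFin (V H)))

SinglyLinked : ∀ {k} → Fin k → Heap k → Set
SinglyLinked null H =
  ∀ v → (outdeg H v ≡ 1 × v ≢ L H null) ⊎ (outdeg H v ≡ 0 × v ≡ L H null)

-- Subdivision of the edge (u,v) with weights a, b; the fresh vertex is
-- `zero`, old vertices are embedded by `suc`.

subdivide : ∀ {k} (H : Heap k) → (u v : Fin (V H)) → (a b : ℕ) → Heap k
subdivide {k} H u v a b = heap (ℕ.suc (V H)) w' (λ p → suc (L H p))
  where
  w' : Fin (ℕ.suc (V H)) → Fin (ℕ.suc (V H)) → Maybe ℕ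
  w' zero zero = nothing
  w' zero (suc t) = if does (t ≟ v) then just b else nothing
  w' (suc s) zero = if does (s ≟ u) then just a else nothing
  w' (suc s) (suc t) = if does (s ≟ u) ∧ does (t ≟ v) then nothing else w H s t

data Subdivision {k} (H : Heap k) : Heap k → Set where
  done : Subdivision H H
  step : ∀ {H'} → Subdivision H H' →
         (u v : Fin (V H')) (a b : ℕ) → 0 < a → 0 < b →
         w H' u v ≡ just (a + b) →
         Subdivision H (subdivide H' u v a b)

data Path {k} (H : Heap k) : Fin (V H) → Fin (V H) → Set where
  here  : ∀ {v} → Path H v v
  there : ∀ {u v t n} → w H u v ≡ just n → Path H v t → Path H u t

Reachable : ∀ {k} (H : Heap k) → Fin (V H) → Set
Reachable {k} H v = Σ (Fin k) λ p → Path H (L H p) v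

record Iso {k} (H H' : Heap k) : Set where
  field
    f : Fin (V H) → Fin (V H')
    g : Fin (V H') → Fin (V H)
    f-reach : ∀ v → Reachable H v → Reachable H' (f v)
    g-reach : ∀ v → Reachable H' v → Reachable H (g v)
    g∘f : ∀ v → Reachable H v → g (f v) ≡ v
    f∘g : ∀ v → Reachable H' v → f (g v) ≡ v
    f-L : ∀ p → f (L H p) ≡ L H' p
    f-w : ∀ u v → Reachable H u → Reachable H v → w H u v ≡ w H' (f u) (f v)

_∼_ : ∀ {k} → Heap k → Heap k → Set
_∼_ {k} H H' = Σ (Heap k) λ S → Σ (Heap k) λ S' →
  Subdivision H S × Subdivision H' S' × Iso S S'

newH : ∀ {k} → Fin k → Heap k → Fin k → Heap k
newH null H x = heap (ℕ.suc (V H)) w' ((λ p → suc (L H p)) [ x ↦ zero ])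
  where
  w' : Fin (ℕ.suc (V H)) → Fin (ℕ.suc (V H)) → Maybe ℕ
  w' zero zero = nothing
  w' zero (suc t) = if does (t ≟ L H null) then just 1 else nothing
  w' (suc s) zero = nothing
  w' (suc s) (suc t) = w H s t

assignH : ∀ {k} → Heap k → Fin k → Fin k → Heap k
assignH H x y = heap (V H) (w H) (L H [ x ↦ L H y ])

outs : ∀ {k} (H : Heap k) → Fin (V H) → List (Fin (V H) × ℕ)
outs H v = mapMaybe (λ t → Maybe.map (λ n → t , n) (w H v t)) (allFin (V H))

-- lookup (only meaningful when L(y) has an outgoing edge)
lookupH : ∀ {k} → Heap k → Fin k → Fin k → Heap k
lookupH H x y with outs H (L H y)
... | [] = H
... | (t , n) ∷ _ with n ℕ.≟ 1
...   | yes _ = heap (V H) (w H) (L H [ x ↦ t ])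
...   | no _ = heap (V S) (w S) (L S [ x ↦ zero ])
  where S = subdivide H (L H y) t 1 (n ∸ 1)

updateH : ∀ {k} → Heap k → Fin k → Fin k → Heap k
updateH H x y = heap (V H) w' (L H)
  where
  w' : Fin (V H) → Fin (V H) → Maybe ℕ
  w' s t = if does (s ≟ L H x)
           then (if does (t ≟ L H y) then just 1 else nothing)
           else w H s t

data Transformer (k : ℕ) : Set where
  new    : Fin k → Transformer k
  assign : Fin k → Fin k → Transformer k
  lookup : Fin k → Fin k → Transformer k
  update : Fin k → Fin k → Transformer k

apply : ∀ {k} → Fin k → Transformer k → Heap k → Heap k
apply null (new x) H = newH null H x
apply null (assign x y) H = assignH H x y
apply null (lookup x y) H = lookupH H x y
apply null (update x y) H = updateH H x y

-- Side condition: lookup/update only where the required successor exists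
-- (in a singly linked heap: the vertex is not L(null)).
Applicable : ∀ {k} → Fin k → Transformer k → Heap k → Set
Applicable null (new x) H = ⊤
Applicable null (assign x y) H = ⊤
Applicable null (lookup x y) H = L H y ≢ L H null
Applicable null (update x y) H = L H x ≢ L H null

-- Let H₁ ∼ H₂ be witnessed by subdivisions S₁, S₂ and an isomorphism S₁ ≅ S₂
-- of reachable parts.  For each transformer τ we prove two facts:
--  (a) τ respects isomorphism: S₁ ≅ S₂ implies τ S₁ ≅ τ S₂;
--  (b) τ commutes with subdivision up to unreachable junk: if S is a
--      subdivision of H, some subdivision T of τ H *embeds* into τ S, i.e. is
--      isomorphic to τ S by a map whose image contains all of τ S's reachable part.
-- Then τ H₁ ⊑ T₁ ≅ τ S₁ ≅ τ S₂ ≅ T₂ ⊒ τ H₂ shows τ H₁ ∼ τ H₂.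
--
-- (b) goes by induction on the subdivision, one step at a time; the general
-- fact behind it is that a subdivision step of the target of an embedding is
-- matched by at most one subdivision step of its source (subemb-subdivide).
-- For lookup, being singly linked supplies that every vertex has at most one
-- successor and that L(y) has one; both survive subdivision.

module Submission where

open import Defs
open import Data.Nat as ℕ using (ℕ; _<_; _≤_; _∸_; _+_; z≤n; s≤s)
open import Data.Nat.Properties using (≤-refl; ≤-reflexive; ≤-trans; n≤1+n; 1+n≰n)
open import Data.Fin using (Fin; zero; suc; _≟_)
open import Data.Fin.Properties using (suc-injective)
open import Data.Bool using (Bool; true; false; _∧_)
open import Data.Maybe as Maybe using (Maybe; just; nothing; is-just)
open import Data.List using ([]; _∷_; length; filterᵇ; mapMaybe; tabulate)
open import Data.Product using (Σ; _×_; _,_; proj₁; proj₂)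
open import Data.Sum using (inj₁; inj₂)
open import Data.Empty using (⊥; ⊥-elim)
open import Relation.Binary.PropositionalEquality
open import Relation.Nullary using (yes; no; does; ¬_)
open import Relation.Nullary.Decidable using (dec-true; dec-false)

nothing≢just : ∀ {A : Set} {a : A} → nothing ≢ just a
nothing≢just ()

extend : ∀ {m n} → (Fin m → Fin n) → Fin (ℕ.suc m) → Fin (ℕ.suc n)
extend f zero = zero
extend f (suc s) = suc (f s)

path-snoc : ∀ {k} {H : Heap k} {s u v n} → Path H s u → w H u v ≡ just n → Path H s v
path-snoc here e = there e here
path-snoc (there e' p) e = there e' (path-snoc p e)

reach-label : ∀ {k} (H : Heap k) p → Reachable H (L H p)
reach-label H p = p , here

reach-edge : ∀ {k} {H : Heap k} {s t n} → Reachable H s → w H s t ≡ just n → Reachable H t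
reach-edge (p , q) e = p , path-snoc q e

reach-path : ∀ {k} {H : Heap k} {s t} → Reachable H s → Path H s t → Reachable H t
reach-path r here = r
reach-path r (there e q) = reach-path (reach-edge r e) q

-- Reachability is then transported along f, so two opposite halves form an Iso.
record HalfIso {k} (A B : Heap k) (f : Fin (V A) → Fin (V B)) (g : Fin (V B) → Fin (V A)) : Set where
  field
    f-L : ∀ p → f (L A p) ≡ L B p
    f-w : ∀ s t → Reachable A s → Reachable A t → w A s t ≡ w B (f s) (f t)
    g∘f : ∀ s → Reachable A s → g (f s) ≡ s

module _ {k} {A B : Heap k} {f g} (h : HalfIso A B f g) where
  open HalfIso h

  half-path : ∀ {s t} → Reachable A s → Path A s t → Path B (f s) (f t)
  half-path rs here = here
  half-path rs (there {v = m} e q) =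
    there (trans (sym (f-w _ m rs (reach-edge rs e))) e) (half-path (reach-edge rs e) q)

  half-reach : ∀ {v} → Reachable A v → Reachable B (f v)
  half-reach (p , q) = p , subst (λ z → Path B z (f _)) (f-L p) (half-path (p , here) q)

halves→iso : ∀ {k} {A B : Heap k} {f g} → HalfIso A B f g → HalfIso B A g f → Iso A B
halves→iso {f = f} {g} h₁ h₂ = record
  { f = f ; g = g
  ; f-reach = λ v → half-reach h₁
  ; g-reach = λ v → half-reach h₂
  ; g∘f = HalfIso.g∘f h₁
  ; f∘g = HalfIso.g∘f h₂
  ; f-L = HalfIso.f-L h₁
  ; f-w = HalfIso.f-w h₁ }

iso-sym : ∀ {k} {A B : Heap k} → Iso A B → Iso B A
iso-sym {A = A} {B} ι = record
  { f = g ; g = f ; f-reach = g-reach ; g-reach = f-reach ; g∘f = f∘g ; f∘g = g∘f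
  ; f-L = λ p → trans (cong g (sym (f-L p))) (g∘f _ (reach-label A p))
  ; f-w = λ s t rs rt → trans (cong₂ (w B) (sym (f∘g s rs)) (sym (f∘g t rt)))
                              (sym (f-w (g s) (g t) (g-reach s rs) (g-reach t rt))) }
  where open Iso ι

iso-trans : ∀ {k} {A B C : Heap k} → Iso A B → Iso B C → Iso A C
iso-trans ι κ = record
  { f = λ v → κ.f (ι.f v) ; g = λ v → ι.g (κ.g v)
  ; f-reach = λ v r → κ.f-reach _ (ι.f-reach v r)
  ; g-reach = λ v r → ι.g-reach _ (κ.g-reach v r)
  ; g∘f = λ v r → trans (cong ι.g (κ.g∘f _ (ι.f-reach v r))) (ι.g∘f v r)
  ; f∘g = λ v r → trans (cong κ.f (ι.f∘g _ (κ.g-reach v r))) (κ.f∘g v r)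
  ; f-L = λ p → trans (cong κ.f (ι.f-L p)) (κ.f-L p)
  ; f-w = λ s t rs rt → trans (ι.f-w s t rs rt) (κ.f-w _ _ (ι.f-reach s rs) (ι.f-reach t rt)) }
  where
  module ι = Iso ι
  module κ = Iso κ

≟-transport : ∀ {k} {A B : Heap k} (ι : Iso A B) {s c c'} → Reachable A s → Reachable A c →
  Iso.f ι c ≡ c' → does (s ≟ c) ≡ does (Iso.f ι s ≟ c')
≟-transport ι {s} {c} {c'} rs rc fc with s ≟ c | Iso.f ι s ≟ c'
... | yes _ | yes _ = refl
... | no _ | no _ = refl
... | yes s≡c | no fs≢c' = ⊥-elim (fs≢c' (trans (cong (Iso.f ι) s≡c) fc))
... | no s≢c | yes fs≡c' = ⊥-elim (s≢c (begin
      s             ≡⟨ sym (g∘f s rs) ⟩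
      g (f s)       ≡⟨ cong g (trans fs≡c' (sym fc)) ⟩
      g (f c)       ≡⟨ g∘f c rc ⟩
      c             ∎))
  where
  open Iso ι
  open ≡-Reasoning

-- An embedding of T into U: f has left inverse g, preserves labels and all
-- weights, and no edge leaves the image of f (the vertices c with f (g c) ≡ c).
-- The image then contains U's reachable part, so T ≅ U; this is how unreachable
-- junk left behind by a transformer is discarded.
record Embedding {k} (T U : Heap k) : Set where
  field
    f : Fin (V T) → Fin (V U)
    g : Fin (V U) → Fin (V T)
    g∘f : ∀ s → g (f s) ≡ s
    f-L : ∀ p → f (L T p) ≡ L U p
    f-w : ∀ s t → w T s t ≡ w U (f s) (f t)
    closed : ∀ s c → f (g c) ≢ c → w U (f s) c ≡ nothing

embedding-pointwise : ∀ {k n} {w₁ w₂ : Fin n → Fin n → Maybe ℕ} {L₁ L₂ : Fin k → Fin n} →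
  (∀ s t → w₁ s t ≡ w₂ s t) → (∀ p → L₁ p ≡ L₂ p) → Embedding (heap n w₁ L₁) (heap n w₂ L₂)
embedding-pointwise ew eL = record
  { f = λ v → v ; g = λ v → v ; g∘f = λ _ → refl ; f-L = eL ; f-w = ew
  ; closed = λ s c c≢c → ⊥-elim (c≢c refl) }

embedding-refl : ∀ {k} (H : Heap k) → Embedding H H
embedding-refl H = embedding-pointwise (λ _ _ → refl) (λ _ → refl)

embedding-trans : ∀ {k} {A B C : Heap k} → Embedding A B → Embedding B C → Embedding A C
embedding-trans {B = B} {C} ε κ = record
  { f = λ v → κ.f (ε.f v) ; g = λ v → ε.g (κ.g v)
  ; g∘f = λ s → trans (cong ε.g (κ.g∘f _)) (ε.g∘f s)
  ; f-L = λ p → trans (cong κ.f (ε.f-L p)) (κ.f-L p)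
  ; f-w = λ s t → trans (ε.f-w s t) (κ.f-w _ _)
  ; closed = closed }
  where
  module ε = Embedding ε
  module κ = Embedding κ
  -- c outside the composite image is outside the image of κ, or is κ of a
  -- vertex outside the image of ε.
  closed : ∀ s c → κ.f (ε.f (ε.g (κ.g c))) ≢ c → w C (κ.f (ε.f s)) c ≡ nothing
  closed s c c∉ with κ.f (κ.g c) ≟ c
  ... | no c∉κ = κ.closed _ c c∉κ
  ... | yes c∈κ with ε.f (ε.g (κ.g c)) ≟ κ.g c
  ...   | yes gc∈ε = ⊥-elim (c∉ (trans (cong κ.f gc∈ε) c∈κ))
  ...   | no gc∉ε = begin
          w C (κ.f (ε.f s)) c             ≡⟨ cong (w C (κ.f (ε.f s))) (sym c∈κ) ⟩
          w C (κ.f (ε.f s)) (κ.f (κ.g c)) ≡⟨ sym (κ.f-w _ _) ⟩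
          w B (ε.f s) (κ.g c)             ≡⟨ ε.closed s _ gc∉ε ⟩
          nothing                         ∎
    where open ≡-Reasoning

module _ {k} {T U : Heap k} (ε : Embedding T U) where
  open Embedding ε

  image-edge : ∀ {u v n} → f (g u) ≡ u → w U u v ≡ just n → f (g v) ≡ v
  image-edge {u} {v} u∈ e with f (g v) ≟ v
  ... | yes v∈ = v∈
  ... | no v∉ = ⊥-elim (nothing≢just (trans (sym (closed (g u) v v∉)) (trans (cong (λ z → w U z v) u∈) e)))

  image-path : ∀ {s t} → f (g s) ≡ s → Path U s t → f (g t) ≡ t
  image-path s∈ here = s∈
  image-path s∈ (there e q) = image-path (image-edge s∈ e) q

  image-reach : ∀ {c} → Reachable U c → f (g c) ≡ c
  image-reach (p , q) = image-path label∈ q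
    where
    label∈ : f (g (L U p)) ≡ L U p
    label∈ = trans (cong (λ z → f (g z)) (sym (f-L p))) (trans (cong f (g∘f _)) (f-L p))

  embedding→iso : Iso T U
  embedding→iso = halves→iso forth back
    where
    forth : HalfIso T U f g
    forth = record { f-L = f-L ; f-w = λ s t _ _ → f-w s t ; g∘f = λ s _ → g∘f s }
    back : HalfIso U T g f
    back = record
      { f-L = λ p → trans (cong g (sym (f-L p))) (g∘f _)
      ; f-w = λ s t rs rt → trans (cong₂ (w U) (sym (image-reach rs)) (sym (image-reach rt)))
                                  (sym (f-w (g s) (g t)))
      ; g∘f = λ s → image-reach }

  ≟-retract : ∀ s {c} → f (g c) ≡ c → does (s ≟ g c) ≡ does (f s ≟ c)
  ≟-retract s {c} c∈ with s ≟ g c | f s ≟ c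
  ... | yes _ | yes _ = refl
  ... | no _ | no _ = refl
  ... | yes s≡gc | no fs≢c = ⊥-elim (fs≢c (trans (cong f s≡gc) c∈))
  ... | no s≢gc | yes fs≡c = ⊥-elim (s≢gc (trans (sym (g∘f s)) (cong g fs≡c)))

  subdivide-image : ∀ {u v a b n} → f (g u) ≡ u → w U u v ≡ just n →
    Embedding (subdivide T (g u) (g v) a b) (subdivide U u v a b)
  subdivide-image {u} {v} {a} {b} u∈ e = record
    { f = extend f ; g = extend g ; g∘f = retract ; f-L = λ p → cong suc (f-L p)
    ; f-w = pres ; closed = closed' }
    where
    v∈ : f (g v) ≡ v
    v∈ = image-edge u∈ e
    retract : ∀ s → extend g (extend f s) ≡ s
    retract zero = refl
    retract (suc s) = cong suc (g∘f s)
    pres : ∀ s t → w (subdivide T (g u) (g v) a b) s t ≡ w (subdivide U u v a b) (extend f s) (extend f t)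
    pres zero zero = refl
    pres zero (suc t) rewrite ≟-retract t v∈ = refl
    pres (suc s) zero rewrite ≟-retract s u∈ = refl
    pres (suc s) (suc t) rewrite ≟-retract t v∈ | ≟-retract s u∈
      with does (f s ≟ u) | does (f t ≟ v)
    ... | true | true = refl
    ... | true | false = f-w s t
    ... | false | _ = f-w s t
    ≢v : ∀ {c} → suc (f (g c)) ≢ suc c → c ≢ v
    ≢v c∉ c≡v = c∉ (cong suc (subst (λ z → f (g z) ≡ z) (sym c≡v) v∈))
    closed' : ∀ s c → extend f (extend g c) ≢ c → w (subdivide U u v a b) (extend f s) c ≡ nothing
    closed' s zero c∉ = ⊥-elim (c∉ refl)
    closed' zero (suc c) c∉ rewrite dec-false (c ≟ v) (≢v c∉) = refl
    closed' (suc s) (suc c) c∉ rewrite dec-false (c ≟ v) (≢v c∉) with does (f s ≟ u)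
    ... | true = closed s c (λ c∈ → c∉ (cong suc c∈))
    ... | false = closed s c (λ c∈ → c∉ (cong suc c∈))

  subdivide-outside : ∀ {u v a b} → f (g u) ≢ u → Embedding T (subdivide U u v a b)
  subdivide-outside {u} {v} {a} {b} u∉ = record
    { f = λ s → suc (f s) ; g = g' ; g∘f = g∘f ; f-L = λ p → cong suc (f-L p)
    ; f-w = pres ; closed = closed' }
    where
    f≢u : ∀ s → f s ≢ u
    f≢u s fs≡u = u∉ (trans (cong f (trans (cong g (sym fs≡u)) (g∘f s))) fs≡u)
    g' : Fin (ℕ.suc (V U)) → Fin (V T)
    g' zero = g u
    g' (suc c) = g c
    pres : ∀ s t → w T s t ≡ w (subdivide U u v a b) (suc (f s)) (suc (f t))
    pres s t rewrite dec-false (f s ≟ u) (f≢u s) = f-w s t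
    closed' : ∀ s c → suc (f (g' c)) ≢ c → w (subdivide U u v a b) (suc (f s)) c ≡ nothing
    closed' s zero _ rewrite dec-false (f s ≟ u) (f≢u s) = refl
    closed' s (suc c) c∉ rewrite dec-false (f s ≟ u) (f≢u s) = closed s c (λ c∈ → c∉ (cong suc c∈))

-- Some subdivision of H embeds into U.  This is the form in which a
-- transformer commutes with subdivision.
SubEmb : ∀ {k} → Heap k → Heap k → Set
SubEmb {k} H U = Σ (Heap k) λ T → Subdivision H T × Embedding T U

subemb-embed : ∀ {k} {H U U' : Heap k} → SubEmb H U → Embedding U U' → SubEmb H U'
subemb-embed (T , sd , ε) κ = T , sd , embedding-trans ε κ

subemb-subdivide : ∀ {k} {H U : Heap k} → SubEmb H U →
  ∀ u v a b → 0 < a → 0 < b → w U u v ≡ just (a + b) → SubEmb H (subdivide U u v a b)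
subemb-subdivide {U = U} (T , sd , ε) u v a b a>0 b>0 e with Embedding.f ε (Embedding.g ε u) ≟ u
... | yes u∈ = _ , step sd _ _ a b a>0 b>0 e' , subdivide-image ε u∈ e
  where
  open Embedding ε
  e' : w T (g u) (g v) ≡ just (a + b)
  e' = trans (f-w _ _) (trans (cong₂ (w U) u∈ (image-edge ε u∈ e)) e)
... | no u∉ = T , sd , subdivide-outside ε u∉

homeomorphic : ∀ {k} {H₁ H₂ S₁ S₂ : Heap k} → SubEmb H₁ S₁ → SubEmb H₂ S₂ → Iso S₁ S₂ → H₁ ∼ H₂
homeomorphic (T₁ , sd₁ , ε₁) (T₂ , sd₂ , ε₂) ι =
  T₁ , T₂ , sd₁ , sd₂ , iso-trans (embedding→iso ε₁) (iso-trans ι (iso-sym (embedding→iso ε₂)))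

StepCommutes : ∀ {k} → (Heap k → Heap k) → Heap k → Set
StepCommutes {k} τ H = ∀ {S} → Subdivision H S →
  ∀ u v a b → 0 < a → 0 < b → w S u v ≡ just (a + b) →
  SubEmb (τ H) (τ S) → SubEmb (τ H) (τ (subdivide S u v a b))

commutes : ∀ {k} {τ : Heap k → Heap k} {H S} → StepCommutes τ H → Subdivision H S → SubEmb (τ H) (τ S)
commutes {τ = τ} {H} _ done = τ H , done , embedding-refl (τ H)
commutes st (step sd u v a b a>0 b>0 e) = st sd u v a b a>0 b>0 e (commutes st sd)

subdivision-invariant : ∀ {k} (P : Heap k → Set) →
  (∀ {S} u v a b {n} → w S u v ≡ just n → P S → P (subdivide S u v a b)) →
  ∀ {H S} → Subdivision H S → P H → P S
subdivision-invariant P pres done pH = pH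
subdivision-invariant P pres (step sd u v a b _ _ e) pH = pres u v a b e (subdivision-invariant P pres sd pH)

-- The edges of a subdivided heap: the two new edges through the fresh vertex
-- `zero`, and the old edges other than (u,v).  Paths project back to the
-- original heap by sending `zero` to u.
module Subdivided {k} (A : Heap k) (u v : Fin (V A)) (a b : ℕ) where
  S : Heap k
  S = subdivide A u v a b

  edge-in : ∀ {s} → s ≡ u → w S (suc s) zero ≡ just a
  edge-in s≡u rewrite dec-true (_ ≟ u) s≡u = refl

  edge-out : ∀ {t} → t ≡ v → w S zero (suc t) ≡ just b
  edge-out t≡v rewrite dec-true (_ ≟ v) t≡v = refl

  edge-old : ∀ s t → ¬ (s ≡ u × t ≡ v) → w S (suc s) (suc t) ≡ w A s t
  edge-old s t ne with s ≟ u | t ≟ v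
  ... | yes s≡u | yes t≡v = ⊥-elim (ne (s≡u , t≡v))
  ... | yes _ | no _ = refl
  ... | no _ | _ = refl

  from-fresh : ∀ {t n} → w S zero t ≡ just n → t ≡ suc v
  from-fresh {zero} ()
  from-fresh {suc t} e with t ≟ v
  ... | yes t≡v = cong suc t≡v
  ... | no _ = ⊥-elim (nothing≢just e)

  into-fresh : ∀ {s n} → w S (suc s) zero ≡ just n → s ≡ u
  into-fresh {s} e with s ≟ u
  ... | yes s≡u = s≡u
  ... | no _ = ⊥-elim (nothing≢just e)

  old-edge : ∀ {s t n} → w S (suc s) (suc t) ≡ just n → w A s t ≡ just n × ¬ (s ≡ u × t ≡ v)
  old-edge {s} {t} e with s ≟ u | t ≟ v
  ... | yes _ | yes _ = ⊥-elim (nothing≢just e)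
  ... | yes _ | no t≢v = e , λ st → t≢v (proj₂ st)
  ... | no s≢u | _ = e , λ st → s≢u (proj₁ st)

  path-forward : ∀ {s t} → Path A s t → Path S (suc s) (suc t)
  path-forward here = here
  path-forward {s} (there {v = m} e q) with s ≟ u | m ≟ v
  ... | yes s≡u | yes m≡v = there {v = zero} (edge-in s≡u) (there (edge-out m≡v) (path-forward q))
  ... | yes _ | no m≢v = there (trans (edge-old s m (λ sm → m≢v (proj₂ sm))) e) (path-forward q)
  ... | no s≢u | _ = there (trans (edge-old s m (λ sm → s≢u (proj₁ sm))) e) (path-forward q)

  reach-fresh : Reachable A u → Reachable S zero
  reach-fresh (p , q) = reach-edge (p , path-forward q) (edge-in refl)

  project : Fin (V S) → Fin (V A)
  project zero = u
  project (suc s) = s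

  path-back : ∀ {m} → w A u v ≡ just m → ∀ {c d} → Path S c d → Path A (project c) (project d)
  path-back e here = here
  path-back e {zero} (there {v = t} e' q) with from-fresh {t} e'
  ... | refl = there e (path-back e q)
  path-back e {suc s} (there {v = zero} e' q) with into-fresh {s} e'
  ... | refl = path-back e q
  path-back e {suc s} (there {v = suc t} e' q) = there (proj₁ (old-edge e')) (path-back e q)

  reach-back : ∀ {m} → w A u v ≡ just m → ∀ {c} → Reachable S c → Reachable A (project c)
  reach-back e (p , q) = p , path-back e q

subdivide-half : ∀ {k} {A B : Heap k} (ι : Iso A B) {u v u' v' a b m} →
  Reachable A u → w A u v ≡ just m → Iso.f ι u ≡ u' → Iso.f ι v ≡ v' →
  HalfIso (subdivide A u v a b) (subdivide B u' v' a b) (extend (Iso.f ι)) (extend (Iso.g ι))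
subdivide-half {A = A} {B} ι {u} {v} {u'} {v'} {a} {b} ru e fu fv = record
  { f-L = λ p → cong suc (f-L p) ; f-w = pres ; g∘f = retract }
  where
  open Iso ι
  open Subdivided A u v a b
  rv : Reachable A v
  rv = reach-edge ru e
  back : ∀ {c} → Reachable S c → Reachable A (project c)
  back = reach-back e
  pres : ∀ s t → Reachable S s → Reachable S t → w S s t ≡ w (subdivide B u' v' a b) (extend f s) (extend f t)
  pres zero zero _ _ = refl
  pres zero (suc t) _ rt rewrite ≟-transport ι (back rt) rv fv = refl
  pres (suc s) zero rs _ rewrite ≟-transport ι (back rs) ru fu = refl
  pres (suc s) (suc t) rs rt rewrite ≟-transport ι (back rs) ru fu | ≟-transport ι (back rt) rv fv
    with does (f s ≟ u') | does (f t ≟ v')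
  ... | true | true = refl
  ... | true | false = f-w s t (back rs) (back rt)
  ... | false | _ = f-w s t (back rs) (back rt)
  retract : ∀ s → Reachable S s → extend g (extend f s) ≡ s
  retract zero _ = refl
  retract (suc s) r = cong suc (g∘f s (back r))

subdivide-iso : ∀ {k} {A B : Heap k} (ι : Iso A B) {u v u' v' a b m} →
  Reachable A u → w A u v ≡ just m → Iso.f ι u ≡ u' → Iso.f ι v ≡ v' →
  Iso (subdivide A u v a b) (subdivide B u' v' a b)
subdivide-iso {A = A} {B} ι {u} {v} {u'} {v'} {m = m} ru e fu fv =
  halves→iso (subdivide-half ι ru e fu fv) (subdivide-half (iso-sym ι) ru' e' gu gv)
  where
  open Iso ι
  rv : Reachable A v
  rv = reach-edge ru e
  ru' : Reachable B u'
  ru' = subst (Reachable B) fu (f-reach u ru)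
  e' : w B u' v' ≡ just m
  e' = trans (cong₂ (w B) (sym fu) (sym fv)) (trans (sym (f-w u v ru rv)) e)
  gu : g u' ≡ u
  gu = trans (cong g (sym fu)) (g∘f u ru)
  gv : g v' ≡ v
  gv = trans (cong g (sym fv)) (g∘f v rv)

-- Moving the label x onto the vertex c.  assign(H,x,y) is relabel H x (L H y),
-- and lookup is a relabelling, possibly after splitting off a unit edge.
relabel : ∀ {k} (H : Heap k) → Fin k → Fin (V H) → Heap k
relabel H x c = heap (V H) (w H) (L H [ x ↦ c ])

relabel-all : ∀ {k n} (P : Fin n → Set) (L : Fin k → Fin n) x {c} → P c → (∀ p → P (L p)) →
  ∀ p → P ((L [ x ↦ c ]) p)
relabel-all P L x Pc PL p with p ≟ x
... | yes _ = Pc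
... | no _ = PL p

relabel-map : ∀ {k m n} (f : Fin m → Fin n) (L : Fin k → Fin m) (L' : Fin k → Fin n) x {c c'} →
  f c ≡ c' → (∀ p → f (L p) ≡ L' p) → ∀ p → f ((L [ x ↦ c ]) p) ≡ (L' [ x ↦ c' ]) p
relabel-map f L L' x fc fL p with p ≟ x
... | yes _ = fc
... | no _ = fL p

reach-transfer : ∀ {k} (A : Heap k) {w' : Fin (V A) → Fin (V A) → Maybe ℕ} {L' : Fin k → Fin (V A)} →
  (∀ p → Reachable A (L' p)) → (∀ {s t n} → Reachable A s → w' s t ≡ just n → Reachable A t) →
  ∀ {v} → Reachable (heap (V A) w' L') v → Reachable A v
reach-transfer A {w'} {L'} labels edges (p , q) = along (labels p) q
  where
  along : ∀ {s t} → Reachable A s → Path (heap (V A) w' L') s t → Reachable A t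
  along r here = r
  along r (there e q) = along (edges r e) q

modified-half : ∀ {k} {A B : Heap k} (ι : Iso A B)
  {wA : Fin (V A) → Fin (V A) → Maybe ℕ} {LA : Fin k → Fin (V A)}
  {wB : Fin (V B) → Fin (V B) → Maybe ℕ} {LB : Fin k → Fin (V B)} →
  (∀ {v} → Reachable (heap (V A) wA LA) v → Reachable A v) →
  (∀ p → Iso.f ι (LA p) ≡ LB p) →
  (∀ s t → Reachable A s → Reachable A t → wA s t ≡ wB (Iso.f ι s) (Iso.f ι t)) →
  HalfIso (heap (V A) wA LA) (heap (V B) wB LB) (Iso.f ι) (Iso.g ι)
modified-half ι inA f-L f-w = record
  { f-L = f-L ; f-w = λ s t rs rt → f-w s t (inA rs) (inA rt) ; g∘f = λ s r → Iso.g∘f ι s (inA r) }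

relabel-half : ∀ {k} {A B : Heap k} (ι : Iso A B) x {c c'} → Reachable A c → Iso.f ι c ≡ c' →
  HalfIso (relabel A x c) (relabel B x c') (Iso.f ι) (Iso.g ι)
relabel-half {A = A} {B} ι x rc fc = modified-half ι
  (reach-transfer A (relabel-all (Reachable A) (L A) x rc (reach-label A)) reach-edge)
  (relabel-map (Iso.f ι) (L A) (L B) x fc (Iso.f-L ι))
  (Iso.f-w ι)

relabel-iso : ∀ {k} {A B : Heap k} (ι : Iso A B) x {c c'} → Reachable A c → Iso.f ι c ≡ c' →
  Iso (relabel A x c) (relabel B x c')
relabel-iso {B = B} ι x {c} rc fc = halves→iso (relabel-half ι x rc fc)
  (relabel-half (iso-sym ι) x (subst (Reachable B) fc (Iso.f-reach ι c rc))
     (trans (cong (Iso.g ι) (sym fc)) (Iso.g∘f ι c rc)))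

-- update respects isomorphism: the redirected edge goes to a labelled vertex.
update-half : ∀ {k} {A B : Heap k} (ι : Iso A B) x y →
  HalfIso (updateH A x y) (updateH B x y) (Iso.f ι) (Iso.g ι)
update-half {A = A} {B} ι x y = modified-half ι (reach-transfer A (reach-label A) edges) (Iso.f-L ι) pres
  where
  edges : ∀ {s t n} → Reachable A s → w (updateH A x y) s t ≡ just n → Reachable A t
  edges {s} {t} r e with s ≟ L A x | t ≟ L A y
  ... | yes _ | yes t≡y = subst (Reachable A) (sym t≡y) (reach-label A y)
  ... | yes _ | no _ = ⊥-elim (nothing≢just e)
  ... | no _ | _ = reach-edge r e
  pres : ∀ s t → Reachable A s → Reachable A t →
    w (updateH A x y) s t ≡ w (updateH B x y) (Iso.f ι s) (Iso.f ι t)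
  pres s t rs rt rewrite ≟-transport ι rs (reach-label A x) (Iso.f-L ι x)
                       | ≟-transport ι rt (reach-label A y) (Iso.f-L ι y)
    with does (Iso.f ι s ≟ L B x)
  ... | true = refl
  ... | false = Iso.f-w ι s t rs rt

update-iso : ∀ {k} {A B : Heap k} (ι : Iso A B) x y → Iso (updateH A x y) (updateH B x y)
update-iso ι x y = halves→iso (update-half ι x y) (update-half (iso-sym ι) x y)

-- In new(A,x) the fresh vertex `zero` only points to L(null); projecting it
-- there sends reachable vertices to reachable vertices of A.
module Fresh {k} (null : Fin k) (A : Heap k) (x : Fin k) where
  N : Heap k
  N = newH null A x

  project : Fin (V N) → Fin (V A)
  project zero = L A null
  project (suc s) = s

  path-back : ∀ {c d} → Path N c d → Path A (project c) (project d)
  path-back here = here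
  path-back {zero} (there {v = zero} () q)
  path-back {zero} (there {v = suc t} e q) with t ≟ L A null
  ... | yes t≡null = subst (λ z → Path A z _) t≡null (path-back q)
  ... | no _ = ⊥-elim (nothing≢just e)
  path-back {suc s} (there {v = zero} () q)
  path-back {suc s} (there {v = suc t} e q) = there e (path-back q)

  reach-back : ∀ {c} → Reachable N c → Reachable A (project c)
  reach-back (p , q) = reach-path (relabel-all (λ c → Reachable A (project c)) (λ p → suc (L A p)) x
                                     (reach-label A null) (reach-label A) p) (path-back q)

new-half : ∀ {k} (null : Fin k) {A B : Heap k} (ι : Iso A B) x →
  HalfIso (newH null A x) (newH null B x) (extend (Iso.f ι)) (extend (Iso.g ι))
new-half null {A} {B} ι x = record
  { f-L = relabel-map (extend f) _ _ x refl (λ p → cong suc (f-L p)) ; f-w = pres ; g∘f = retract }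
  where
  open Iso ι
  open Fresh null A x
  pres : ∀ s t → Reachable N s → Reachable N t → w N s t ≡ w (newH null B x) (extend f s) (extend f t)
  pres zero zero _ _ = refl
  pres zero (suc t) _ rt rewrite ≟-transport ι (reach-back rt) (reach-label A null) (f-L null) = refl
  pres (suc s) zero _ _ = refl
  pres (suc s) (suc t) rs rt = f-w s t (reach-back rs) (reach-back rt)
  retract : ∀ s → Reachable N s → extend g (extend f s) ≡ s
  retract zero _ = refl
  retract (suc s) r = cong suc (g∘f s (reach-back r))

new-iso : ∀ {k} (null : Fin k) {A B : Heap k} (ι : Iso A B) x → Iso (newH null A x) (newH null B x)
new-iso null ι x = halves→iso (new-half null ι x) (new-half null (iso-sym ι) x)

Functional : ∀ {k} → Heap k → Set
Functional H = ∀ s {t t' n n'} → w H s t ≡ just n → w H s t' ≡ just n' → t ≡ t'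

HasSucc : ∀ {k} → Heap k → Fin k → Set
HasSucc H y = Σ (Fin (V H)) λ t → Σ ℕ λ n → w H (L H y) t ≡ just n

module _ {A B : Set} (h : A → Maybe B) where
  mapMaybe-none : ∀ {n} (φ : Fin n → A) → (∀ j → h (φ j) ≡ nothing) → mapMaybe h (tabulate φ) ≡ []
  mapMaybe-none {ℕ.zero} φ _ = refl
  mapMaybe-none {ℕ.suc n} φ none rewrite none zero = mapMaybe-none (λ j → φ (suc j)) (λ j → none (suc j))

  mapMaybe-single : ∀ {n} (φ : Fin n → A) i {b} → h (φ i) ≡ just b → (∀ j → j ≢ i → h (φ j) ≡ nothing) →
    mapMaybe h (tabulate φ) ≡ b ∷ []
  mapMaybe-single φ zero e others rewrite e =
    cong (_ ∷_) (mapMaybe-none (λ j → φ (suc j)) (λ j → others (suc j) λ ()))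
  mapMaybe-single φ (suc i) e others rewrite others zero (λ ()) =
    mapMaybe-single (λ j → φ (suc j)) i e (λ j j≢i → others (suc j) (λ sj≡si → j≢i (suc-injective sj≡si)))

outs-single : ∀ {k} {H : Heap k} → Functional H → ∀ {u t n} → w H u t ≡ just n → outs H u ≡ (t , n) ∷ []
outs-single {H = H} fH {u} {t} {n} e =
  mapMaybe-single (λ t → Maybe.map (t ,_) (w H u t)) (λ i → i) t (cong (Maybe.map _) e) others
  where
  others : ∀ j → j ≢ t → Maybe.map (j ,_) (w H u j) ≡ nothing
  others j j≢t with w H u j in ej
  ... | nothing = refl
  ... | just m = ⊥-elim (j≢t (fH u ej e))

lookup-unit : ∀ {k} {H : Heap k} x y → Functional H → ∀ {t} → w H (L H y) t ≡ just 1 →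
  lookupH H x y ≡ relabel H x t
lookup-unit {H = H} x y fH e rewrite outs-single {H = H} fH e = refl

lookup-split : ∀ {k} {H : Heap k} x y → Functional H → ∀ {t n} → w H (L H y) t ≡ just n → n ≢ 1 →
  lookupH H x y ≡ relabel (subdivide H (L H y) t 1 (n ∸ 1)) x zero
lookup-split {H = H} x y fH {n = n} e n≢1 rewrite outs-single {H = H} fH e with n ℕ.≟ 1
... | yes n≡1 = ⊥-elim (n≢1 n≡1)
... | no _ = refl

iso-edge : ∀ {k} {A B : Heap k} (ι : Iso A B) y {t n} → w A (L A y) t ≡ just n →
  w B (L B y) (Iso.f ι t) ≡ just n
iso-edge {A = A} {B} ι y {t} e =
  trans (cong (λ z → w B z (Iso.f ι t)) (sym (Iso.f-L ι y)))
        (trans (sym (Iso.f-w ι _ _ (reach-label A y) (reach-edge (reach-label A y) e))) e)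

lookup-iso : ∀ {k} {A B : Heap k} (ι : Iso A B) x y → Functional A × HasSucc A y → Functional B →
  Iso (lookupH A x y) (lookupH B x y)
lookup-iso {A = A} ι x y (fA , t , n , e) fB with n ℕ.≟ 1
... | yes refl = subst₂ Iso (sym (lookup-unit x y fA e)) (sym (lookup-unit x y fB (iso-edge ι y e)))
  (relabel-iso ι x (reach-edge (reach-label A y) e) refl)
... | no n≢1 = subst₂ Iso (sym (lookup-split x y fA e n≢1)) (sym (lookup-split x y fB (iso-edge ι y e) n≢1))
  (relabel-iso (subdivide-iso ι (reach-label A y) e (Iso.f-L ι y) refl) x
    (Subdivided.reach-fresh A (L A y) t 1 (n ∸ 1) (reach-label A y)) refl)

relabel-subdivide : ∀ {k} (H : Heap k) x c u v a b →
  Embedding (subdivide (relabel H x c) u v a b) (relabel (subdivide H u v a b) x (suc c))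
relabel-subdivide H x c u v a b =
  embedding-pointwise weights (relabel-map suc (L H) (λ p → suc (L H p)) x refl (λ _ → refl))
  where
  weights : ∀ s t → w (subdivide (relabel H x c) u v a b) s t ≡ w (subdivide H u v a b) s t
  weights zero zero = refl
  weights zero (suc t) = refl
  weights (suc s) zero = refl
  weights (suc s) (suc t) = refl

assign-commutes : ∀ {k} x y (H : Heap k) → StepCommutes (λ S → assignH S x y) H
assign-commutes x y H {S} _ u v a b a>0 b>0 e r =
  subemb-embed (subemb-subdivide r u v a b a>0 b>0 e) (relabel-subdivide S x (L S y) u v a b)

-- Exchanging the two most recently created vertices.  Creating two fresh
-- vertices in either order gives heaps related by swap.
swap : ∀ {n} → Fin (ℕ.suc (ℕ.suc n)) → Fin (ℕ.suc (ℕ.suc n))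
swap zero = suc zero
swap (suc zero) = zero
swap (suc (suc s)) = suc (suc s)

swap-involutive : ∀ {n} (s : Fin (ℕ.suc (ℕ.suc n))) → swap (swap s) ≡ s
swap-involutive zero = refl
swap-involutive (suc zero) = refl
swap-involutive (suc (suc s)) = refl

swap-embedding : ∀ {k n} {w₁ w₂ : Fin (ℕ.suc (ℕ.suc n)) → Fin (ℕ.suc (ℕ.suc n)) → Maybe ℕ}
  {L₁ L₂ : Fin k → Fin (ℕ.suc (ℕ.suc n))} →
  (∀ s t → w₁ s t ≡ w₂ (swap s) (swap t)) → (∀ p → swap (L₁ p) ≡ L₂ p) →
  Embedding (heap _ w₁ L₁) (heap _ w₂ L₂)
swap-embedding ew eL = record
  { f = swap ; g = swap ; g∘f = swap-involutive ; f-L = eL ; f-w = ew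
  ; closed = λ s c c∉ → ⊥-elim (c∉ (swap-involutive c)) }

swap-labels : ∀ {k n} (L : Fin k → Fin n) x p →
  swap (suc (((λ p → suc (L p)) [ x ↦ zero ]) p)) ≡ ((λ p → suc (suc (L p))) [ x ↦ zero ]) p
swap-labels L x p with p ≟ x
... | yes _ = refl
... | no _ = refl

new-subdivide : ∀ {k} (null : Fin k) (S : Heap k) x u v a b →
  Embedding (subdivide (newH null S x) (suc u) (suc v) a b) (newH null (subdivide S u v a b) x)
new-subdivide null S x u v a b = swap-embedding weights (swap-labels (L S) x)
  where
  weights : ∀ s t → w (subdivide (newH null S x) (suc u) (suc v) a b) s t
                  ≡ w (newH null (subdivide S u v a b) x) (swap s) (swap t)
  weights zero zero = refl
  weights zero (suc zero) = refl
  weights zero (suc (suc t)) = refl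
  weights (suc zero) zero = refl
  weights (suc zero) (suc zero) = refl
  weights (suc zero) (suc (suc t)) = refl
  weights (suc (suc s)) zero = refl
  weights (suc (suc s)) (suc zero) with does (s ≟ u)
  ... | true = refl
  ... | false = refl
  weights (suc (suc s)) (suc (suc t)) = refl

new-commutes : ∀ {k} (null : Fin k) x (H : Heap k) → StepCommutes (λ S → newH null S x) H
new-commutes null x H {S} _ u v a b a>0 b>0 e r =
  subemb-embed (subemb-subdivide r (suc u) (suc v) a b a>0 b>0 e) (new-subdivide null S x u v a b)

-- Subdividing the edge that update discards is invisible after the update …
update-subdivide-discarded : ∀ {k} (S : Heap k) x y u v a b → u ≡ L S x →
  Embedding (updateH S x y) (updateH (subdivide S u v a b) x y)
update-subdivide-discarded S x y u v a b u≡x = record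
  { f = suc ; g = project ; g∘f = λ _ → refl ; f-L = λ _ → refl ; f-w = pres ; closed = closed }
  where
  open Subdivided S u v a b using (project)
  ≢u : ∀ {s} → s ≢ L S x → s ≢ u
  ≢u s≢x s≡u = s≢x (trans s≡u u≡x)
  pres : ∀ s t → w (updateH S x y) s t ≡ w (updateH (subdivide S u v a b) x y) (suc s) (suc t)
  pres s t with s ≟ L S x
  ... | yes _ = refl
  ... | no s≢x rewrite dec-false (s ≟ u) (≢u s≢x) = refl
  closed : ∀ s c → suc (project c) ≢ c → w (updateH (subdivide S u v a b) x y) (suc s) c ≡ nothing
  closed s (suc c) c∉ = ⊥-elim (c∉ refl)
  closed s zero _ with s ≟ L S x
  ... | yes _ = refl
  ... | no s≢x rewrite dec-false (s ≟ u) (≢u s≢x) = refl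

update-subdivide-kept : ∀ {k} (S : Heap k) x y u v a b → u ≢ L S x →
  Embedding (subdivide (updateH S x y) u v a b) (updateH (subdivide S u v a b) x y)
update-subdivide-kept S x y u v a b u≢x = embedding-pointwise weights (λ _ → refl)
  where
  weights : ∀ s t → w (subdivide (updateH S x y) u v a b) s t ≡ w (updateH (subdivide S u v a b) x y) s t
  weights zero zero = refl
  weights zero (suc t) = refl
  weights (suc s) zero with s ≟ L S x
  ... | yes s≡x rewrite dec-false (s ≟ u) (λ s≡u → u≢x (trans (sym s≡u) s≡x)) = refl
  ... | no _ = refl
  weights (suc s) (suc t) with s ≟ L S x
  ... | yes s≡x rewrite dec-false (s ≟ u) (λ s≡u → u≢x (trans (sym s≡u) s≡x)) = refl
  ... | no _ with does (s ≟ u) ∧ does (t ≟ v)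
  ...   | true = refl
  ...   | false = refl

update-commutes : ∀ {k} x y (H : Heap k) → StepCommutes (λ S → updateH S x y) H
update-commutes x y H {S} _ u v a b a>0 b>0 e r with u ≟ L S x
... | yes u≡x = subemb-embed r (update-subdivide-discarded S x y u v a b u≡x)
... | no u≢x = subemb-embed (subemb-subdivide r u v a b a>0 b>0 e') (update-subdivide-kept S x y u v a b u≢x)
  where
  e' : w (updateH S x y) u v ≡ just (a + b)
  e' rewrite dec-false (u ≟ L S x) u≢x = e

-- Subdivision preserves functionality: the fresh vertex has one successor, and
-- the subdivided vertex u loses its old successor v.
functional-subdivide : ∀ {k} {A : Heap k} u v a b {m} → w A u v ≡ just m → Functional A →
  Functional (subdivide A u v a b)
functional-subdivide {A = A} u v a b e fA = functional
  where
  open Subdivided A u v a b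
  no-bypass : ∀ {s t n n'} → w S (suc s) zero ≡ just n → w S (suc s) (suc t) ≡ just n' → ⊥
  no-bypass {s} e₁ e₂ with into-fresh {s} e₁ | old-edge e₂
  ... | refl | e₃ , not-uv = not-uv (refl , fA u e₃ e)
  functional : Functional S
  functional zero {t} {t'} e₁ e₂ = trans (from-fresh {t} e₁) (sym (from-fresh {t'} e₂))
  functional (suc s) {zero} {zero} _ _ = refl
  functional (suc s) {zero} {suc t'} e₁ e₂ = ⊥-elim (no-bypass e₁ e₂)
  functional (suc s) {suc t} {zero} e₁ e₂ = ⊥-elim (no-bypass e₂ e₁)
  functional (suc s) {suc t} {suc t'} e₁ e₂ = cong suc (fA s (proj₁ (old-edge e₁)) (proj₁ (old-edge e₂)))

succ-kept : ∀ {k} (A : Heap k) y u v a b {t n} → u ≢ L A y → w A (L A y) t ≡ just n →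
  w (subdivide A u v a b) (suc (L A y)) (suc t) ≡ just n
succ-kept A y u v a b {t} u≢y e = trans (Subdivided.edge-old A u v a b (L A y) t (λ yt → u≢y (sym (proj₁ yt)))) e

-- Subdivision preserves HasSucc: L(y)'s edge is kept or now enters the fresh vertex.
succ-subdivide : ∀ {k} {A : Heap k} y u v a b → HasSucc A y → HasSucc (subdivide A u v a b) y
succ-subdivide {A = A} y u v a b (t , n , e) with u ≟ L A y
... | yes u≡y = zero , a , Subdivided.edge-in A u v a b (sym u≡y)
... | no u≢y = suc t , n , succ-kept A y u v a b u≢y e

lookup-invariant : ∀ {k} y {H S : Heap k} → Subdivision H S →
  Functional H × HasSucc H y → Functional S × HasSucc S y
lookup-invariant y = subdivision-invariant (λ S → Functional S × HasSucc S y)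
  (λ u v a b e (fS , sS) → functional-subdivide u v a b e fS , succ-subdivide y u v a b sS)

-- Subdividing the edge leaving L(y) into 1 + b is exactly lookup's own split …
lookup-own-unit : ∀ {k} (S : Heap k) x y v b → Functional S → w S (L S y) v ≡ just (2 + b) →
  lookupH (subdivide S (L S y) v 1 (ℕ.suc b)) x y ≡ lookupH S x y
lookup-own-unit S x y v b fS e =
  trans (lookup-unit x y (functional-subdivide _ _ 1 _ e fS) (Subdivided.edge-in S (L S y) v 1 (ℕ.suc b) refl))
        (sym (lookup-split x y fS e (λ ())))

-- … while splitting it into (2 + a) + b differs from lookup's split by one more
-- subdivision of the remainder, up to the order of the two fresh vertices.
lookup-own-swap : ∀ {k} (S : Heap k) x u v a b →
  Embedding (subdivide (relabel (subdivide S u v 1 (ℕ.suc a + b)) x zero) zero (suc v) (ℕ.suc a) b)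
            (relabel (subdivide (subdivide S u v (2 + a) b) (suc u) zero 1 (ℕ.suc a)) x zero)
lookup-own-swap S x u v a b = swap-embedding weights (swap-labels (L S) x)
  where
  weights : ∀ s t → w (subdivide (relabel (subdivide S u v 1 (ℕ.suc a + b)) x zero) zero (suc v) (ℕ.suc a) b) s t
                  ≡ w (subdivide (subdivide S u v (2 + a) b) (suc u) zero 1 (ℕ.suc a)) (swap s) (swap t)
  weights zero zero = refl
  weights zero (suc zero) = refl
  weights zero (suc (suc t)) = refl
  weights (suc zero) zero = refl
  weights (suc zero) (suc zero) = refl
  weights (suc zero) (suc (suc t)) with does (t ≟ v)
  ... | true = refl
  ... | false = refl
  weights (suc (suc s)) zero with does (s ≟ u)
  ... | true = refl
  ... | false = refl
  weights (suc (suc s)) (suc zero) with does (s ≟ u)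
  ... | true = refl
  ... | false = refl
  weights (suc (suc s)) (suc (suc t)) with does (s ≟ u)
  ... | true = refl
  ... | false = refl

lookup-own-edge : ∀ {k} {H : Heap k} (S : Heap k) x y v {a b} → 0 < a → 0 < b → Functional S →
  w S (L S y) v ≡ just (a + b) →
  SubEmb H (lookupH S x y) → SubEmb H (lookupH (subdivide S (L S y) v a b) x y)
lookup-own-edge {H = H} S x y v {1} {ℕ.suc b} _ _ fS e r = subst (SubEmb H) (sym (lookup-own-unit S x y v b fS e)) r
lookup-own-edge {H = H} S x y v {ℕ.suc (ℕ.suc a)} {b} _ b>0 fS e r =
  subst (SubEmb H) (sym splitW)
    (subemb-embed (subemb-subdivide (subst (SubEmb H) splitS r) zero (suc v) (ℕ.suc a) b (s≤s z≤n) b>0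
                                    (Subdivided.edge-out S (L S y) v 1 _ refl))
                  (lookup-own-swap S x (L S y) v a b))
  where
  splitS : lookupH S x y ≡ relabel (subdivide S (L S y) v 1 (ℕ.suc a + b)) x zero
  splitS = lookup-split x y fS e (λ ())
  splitW : lookupH (subdivide S (L S y) v (2 + a) b) x y
         ≡ relabel (subdivide (subdivide S (L S y) v (2 + a) b) (suc (L S y)) zero 1 (ℕ.suc a)) x zero
  splitW = lookup-split x y (functional-subdivide _ _ _ _ e fS) (Subdivided.edge-in S (L S y) v (2 + a) b refl) (λ ())

lookup-other-swap : ∀ {k} (S : Heap k) x u v a b u₁ t n → u ≢ u₁ →
  Embedding (subdivide (relabel (subdivide S u₁ t 1 n) x zero) (suc u) (suc v) a b)
            (relabel (subdivide (subdivide S u v a b) (suc u₁) (suc t) 1 n) x zero)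
lookup-other-swap S x u v a b u₁ t n u≢u₁ = swap-embedding weights (swap-labels (L S) x)
  where
  weights : ∀ s t' → w (subdivide (relabel (subdivide S u₁ t 1 n) x zero) (suc u) (suc v) a b) s t'
                   ≡ w (subdivide (subdivide S u v a b) (suc u₁) (suc t) 1 n) (swap s) (swap t')
  weights zero zero = refl
  weights zero (suc zero) = refl
  weights zero (suc (suc t')) = refl
  weights (suc zero) zero = refl
  weights (suc zero) (suc zero) = refl
  weights (suc zero) (suc (suc t')) = refl
  weights (suc (suc s)) zero with s ≟ u | s ≟ u₁
  ... | yes s≡u | yes s≡u₁ = ⊥-elim (u≢u₁ (trans (sym s≡u) s≡u₁))
  ... | yes _ | no _ = refl
  ... | no _ | yes _ = refl
  ... | no _ | no _ = refl
  weights (suc (suc s)) (suc zero) with s ≟ u | s ≟ u₁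
  ... | yes s≡u | yes s≡u₁ = ⊥-elim (u≢u₁ (trans (sym s≡u) s≡u₁))
  ... | yes _ | no _ = refl
  ... | no _ | yes _ = refl
  ... | no _ | no _ = refl
  weights (suc (suc s)) (suc (suc t')) with s ≟ u | s ≟ u₁
  ... | yes s≡u | yes s≡u₁ = ⊥-elim (u≢u₁ (trans (sym s≡u) s≡u₁))
  ... | yes _ | no _ = refl
  ... | no _ | yes _ = refl
  ... | no _ | no _ = refl

lookup-other-edge : ∀ {k} {H : Heap k} (S : Heap k) x y u v a b {t n} → 0 < a → 0 < b → Functional S →
  u ≢ L S y → w S u v ≡ just (a + b) → w S (L S y) t ≡ just n →
  SubEmb H (lookupH S x y) → SubEmb H (lookupH (subdivide S u v a b) x y)
lookup-other-edge {H = H} S x y u v a b {t} {n} a>0 b>0 fS u≢y e et r with n ℕ.≟ 1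
... | yes refl =
  subst (SubEmb H) (sym (lookup-unit x y (functional-subdivide u v a b e fS) (succ-kept S y u v a b u≢y et)))
    (subemb-embed (subemb-subdivide (subst (SubEmb H) (lookup-unit x y fS et) r) u v a b a>0 b>0 e)
                  (relabel-subdivide S x t u v a b))
... | no n≢1 =
  subst (SubEmb H) (sym (lookup-split x y (functional-subdivide u v a b e fS) (succ-kept S y u v a b u≢y et) n≢1))
    (subemb-embed (subemb-subdivide (subst (SubEmb H) (lookup-split x y fS et n≢1) r) (suc u) (suc v) a b a>0 b>0 e')
                  (lookup-other-swap S x u v a b (L S y) t (n ∸ 1) u≢y))
  where
  e' : w (subdivide S (L S y) t 1 (n ∸ 1)) (suc u) (suc v) ≡ just (a + b)
  e' = trans (Subdivided.edge-old S (L S y) t 1 (n ∸ 1) u v (λ uv → u≢y (proj₁ uv))) e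

lookup-commutes : ∀ {k} x y (H : Heap k) → Functional H × HasSucc H y → StepCommutes (λ S → lookupH S x y) H
lookup-commutes x y H ok {S} sd u v a b a>0 b>0 e r with u ≟ L S y | lookup-invariant y sd ok
... | yes refl | fS , _ = lookup-own-edge S x y v a>0 b>0 fS e r
... | no u≢y | fS , (t , n , et) = lookup-other-edge S x y u v a b a>0 b>0 fS u≢y e et r

module Count {A : Set} (p : A → Bool) where
  count : ∀ {n} → (Fin n → A) → ℕ
  count φ = length (filterᵇ p (tabulate φ))

  count-tail : ∀ {n} (φ : Fin (ℕ.suc n) → A) → count (λ i → φ (suc i)) ≤ count φ
  count-tail φ with p (φ zero)
  ... | true = n≤1+n _
  ... | false = ≤-refl

  count-one : ∀ {n} (φ : Fin n → A) i → p (φ i) ≡ true → 1 ≤ count φ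
  count-one φ zero e rewrite e = s≤s z≤n
  count-one φ (suc i) e = ≤-trans (count-one (λ j → φ (suc j)) i e) (count-tail φ)

  count-two : ∀ {n} (φ : Fin n → A) i j → i ≢ j → p (φ i) ≡ true → p (φ j) ≡ true → 2 ≤ count φ
  count-two φ zero zero i≢j _ _ = ⊥-elim (i≢j refl)
  count-two φ zero (suc j) _ ei ej rewrite ei = s≤s (count-one (λ j → φ (suc j)) j ej)
  count-two φ (suc i) zero _ ei ej rewrite ej = s≤s (count-one (λ j → φ (suc j)) i ei)
  count-two φ (suc i) (suc j) i≢j ei ej =
    ≤-trans (count-two (λ j → φ (suc j)) i j (λ i≡j → i≢j (cong suc i≡j)) ei ej) (count-tail φ)

  count-witness : ∀ {n} (φ : Fin n → A) → 1 ≤ count φ → Σ (Fin n) λ i → p (φ i) ≡ true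
  count-witness {ℕ.zero} φ ()
  count-witness {ℕ.suc n} φ pos with p (φ zero) in e
  ... | true = zero , e
  ... | false with count-witness (λ j → φ (suc j)) pos
  ...   | i , ei = suc i , ei

is-just-edge : ∀ {A : Set} {m : Maybe A} {a} → m ≡ just a → is-just m ≡ true
is-just-edge refl = refl

singly-linked-outdeg : ∀ {k} (null : Fin k) (H : Heap k) → SinglyLinked null H → ∀ v → outdeg H v ≤ 1
singly-linked-outdeg null H sl v with sl v
... | inj₁ (deg≡1 , _) = ≤-reflexive deg≡1
... | inj₂ (deg≡0 , _) = subst (_≤ 1) (sym deg≡0) z≤n

singly-linked-functional : ∀ {k} (null : Fin k) (H : Heap k) → SinglyLinked null H → Functional H
singly-linked-functional null H sl s {t} {t'} e e' with t ≟ t'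
... | yes t≡t' = t≡t'
... | no t≢t' = ⊥-elim (1+n≰n (≤-trans two (singly-linked-outdeg null H sl s)))
  where
  two : 2 ≤ outdeg H s
  two = Count.count-two (λ c → is-just (w H s c)) (λ i → i) t t' t≢t' (is-just-edge e) (is-just-edge e')

singly-linked-lookup : ∀ {k} (null : Fin k) (H : Heap k) y → SinglyLinked null H → L H y ≢ L H null →
  Functional H × HasSucc H y
singly-linked-lookup null H y sl y≢null with sl (L H y)
... | inj₂ (_ , y≡null) = ⊥-elim (y≢null y≡null)
... | inj₁ (deg≡1 , _)
  with Count.count-witness (λ c → is-just (w H (L H y) c)) (λ i → i) (subst (1 ≤_) (sym deg≡1) ≤-refl)
...   | t , _ with w H (L H y) t in e
...     | just n = singly-linked-functional null H sl , t , n , e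

lemma2 : ∀ {k} (null : Fin k) (τ : Transformer k) (H₁ H₂ : Heap k) →
    PositiveWeights H₁ → PositiveWeights H₂ →
    SinglyLinked null H₁ → SinglyLinked null H₂ →
    Applicable null τ H₁ → Applicable null τ H₂ →
    H₁ ∼ H₂ → apply null τ H₁ ∼ apply null τ H₂
lemma2 null (new x) H₁ H₂ _ _ _ _ _ _ (_ , _ , sd₁ , sd₂ , ι) =
  homeomorphic (commutes (new-commutes null x H₁) sd₁) (commutes (new-commutes null x H₂) sd₂)
               (new-iso null ι x)
lemma2 null (assign x y) H₁ H₂ _ _ _ _ _ _ (_ , _ , sd₁ , sd₂ , ι) =
  homeomorphic (commutes (assign-commutes x y H₁) sd₁) (commutes (assign-commutes x y H₂) sd₂)
               (relabel-iso ι x (reach-label _ y) (Iso.f-L ι y))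
lemma2 null (update x y) H₁ H₂ _ _ _ _ _ _ (_ , _ , sd₁ , sd₂ , ι) =
  homeomorphic (commutes (update-commutes x y H₁) sd₁) (commutes (update-commutes x y H₂) sd₂)
               (update-iso ι x y)
lemma2 null (lookup x y) H₁ H₂ _ _ sl₁ sl₂ y≢null₁ y≢null₂ (_ , _ , sd₁ , sd₂ , ι) =
  homeomorphic (commutes (lookup-commutes x y H₁ ok₁) sd₁) (commutes (lookup-commutes x y H₂ ok₂) sd₂)
               (lookup-iso ι x y (lookup-invariant y sd₁ ok₁) (proj₁ (lookup-invariant y sd₂ ok₂)))
  where
  ok₁ : Functional H₁ × HasSucc H₁ y
  ok₁ = singly-linked-lookup null H₁ y sl₁ y≢null₁
  ok₂ : Functional H₂ × HasSucc H₂ y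
  ok₂ = singly-linked-lookup null H₂ y sl₂ y≢null₂
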